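{- Let $T$ be a tree of order $n\geq 3$ having an inner edge $uv$ such that for every $\gamma_t(T)$-set $D$: (1) if $|\{u,v\}\cap D|=1$, say $u\in D$, then $v\in PN_T[u,D]$; and (2) if $|\{u,v\}\cap D|=2$, then $N_T(u)\cap D=\{v\}$ or $N_T(v)\cap D=\{u\}$; moreover, if $N_T(u)\cap D=\{v\}$, then $PN_T[u,D]\neq\emptyset$ and ($PN_T[v,D]\neq\emptyset$ or $N_T(x)\cap D=\{v\}$ for some vertex $x\in(N_T(v)\cap D)\setminus\{u\}$), and symmetrically, if $N_T(v)\cap D=\{u\}$, then $PN_T[v,D]\neq\emptyset$ and ($PN_T[u,D]\neq\emptyset$ or $N_T(x)\cap D=\{u\}$ for some vertex $x\in(N_T(u)\cap D)\setminus\{v\}$). Then $\mathrm{sd}_{\gamma_t}(T)=1$.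
   Context: A set $S\subseteq V(G)$ is a total dominating set of $G$ if every vertex of $G$ is adjacent to a vertex of $S$; $\gamma_t(G)$ is the minimum size of such a set and a $\gamma_t(G)$-set is a total dominating set of that size. An inner edge is an edge not incident with a vertex of degree 1. $N_T(v)$ is the open neighbourhood and $N_T[v]=N_T(v)\cup\{v\}$; for $X\subseteq V$, $N_T[X]=\bigcup_{x\in X}N_T[x]$. For $u\in D\subseteq V(T)$, $PN_T[u,D]=N_T[u]\setminus N_T[D\setminus\{u\}]$. $\mathrm{sd}_{\gamma_t}(G)$ is the minimum number of edges that must be subdivided (each edge at most once, i.e. replaced by a path of length 2 through a new vertex) to increase $\gamma_t$. -}

module Defs where

open import Data.Nat using (ℕ; zero; suc; _+_; _≤_; _<_; _≥_)
open import Data.Fin using (Fin; zero; suc; _↑ʳ_; _≟_)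
open import Data.Fin.Subset using (Subset; _∈_; _∉_; _∩_; ⁅_⁆; ∣_∣; Nonempty)
open import Data.Bool using (Bool; true; false; _∧_; _∨_; not)
open import Data.Vec using (tabulate)
open import Data.List using (List; []; _∷_; length; last)
open import Data.List.Relation.Unary.Linked using (Linked)
open import Data.List.Relation.Unary.Unique.Propositional using (Unique)
open import Data.List.Relation.Unary.AllPairs using (AllPairs)
open import Data.List.Relation.Unary.All using (All)
open import Data.Maybe using (just)
open import Data.Product using (Σ; ∃; _×_; _,_)
open import Data.Sum using (_⊎_)
open import Data.Empty using (⊥)
open import Relation.Nullary using (¬_)
open import Relation.Nullary.Decidable using (⌊_⌋)
open import Relation.Binary.PropositionalEquality using (_≡_; _≢_)
open import Relation.Binary.Construct.Closure.ReflexiveTransitive using (Star)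

Graph : ℕ → Set
Graph n = Fin n → Fin n → Bool

module _ {n : ℕ} (G : Graph n) where

  Adj : Fin n → Fin n → Set
  Adj x y = G x y ≡ true

  IsSimple : Set
  IsSimple = (∀ x y → G x y ≡ G y x) × (∀ x → G x x ≡ false)

  Connected : Set
  Connected = ∀ x y → Star Adj x y

  IsCycle : List (Fin n) → Set
  IsCycle [] = ⊥
  IsCycle (x ∷ xs) =
    (3 ≤ length (x ∷ xs)) × Unique (x ∷ xs) × Linked Adj (x ∷ xs)
    × Σ (Fin n) (λ z → (last (x ∷ xs) ≡ just z) × Adj z x)

  Acyclic : Set
  Acyclic = ∀ (c : List (Fin n)) → ¬ IsCycle c

  IsTree : Set
  IsTree = IsSimple × Connected × Acyclic

  N : Fin n → Subset n
  N v = tabulate (G v)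

  deg : Fin n → ℕ
  deg v = ∣ N v ∣

  InnerEdge : Fin n → Fin n → Set
  InnerEdge u v = Adj u v × deg u ≢ 1 × deg v ≢ 1

  InClosedN : Fin n → Fin n → Set
  InClosedN y x = (y ≡ x) ⊎ (y ∈ N x)

  -- private-neighbourhood membership: y ∈ PN[u,D] = N[u] \ N[D \ {u}]
  InPN : Fin n → Subset n → Fin n → Set
  InPN u D y = InClosedN y u × ¬ (Σ (Fin n) (λ x → x ∈ D × x ≢ u × InClosedN y x))

  PNNonempty : Fin n → Subset n → Set
  PNNonempty u D = Σ (Fin n) (λ y → InPN u D y)

  IsTDS : Subset n → Set
  IsTDS S = ∀ x → Σ (Fin n) (λ y → y ∈ S × Adj x y)

  IsγtSet : Subset n → Set
  IsγtSet D = IsTDS D × (∀ S → IsTDS S → ∣ D ∣ ≤ ∣ S ∣)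

  γtIs : ℕ → Set
  γtIs k = Σ (Subset n) (λ D → IsγtSet D × ∣ D ∣ ≡ k)

-- Subdivision.  Subdividing the edge ab of G (on Fin n) gives a graph on
-- Fin (suc n): the new vertex is zero, old vertex x becomes suc x.

_==_ : {n : ℕ} → Fin n → Fin n → Bool
x == y = ⌊ x ≟ y ⌋

subdivide1 : {n : ℕ} → Graph n → Fin n → Fin n → Graph (suc n)
subdivide1 G a b zero    zero    = false
subdivide1 G a b zero    (suc y) = (y == a) ∨ (y == b)
subdivide1 G a b (suc x) zero    = (x == a) ∨ (x == b)
subdivide1 G a b (suc x) (suc y) =
  G x y ∧ not (((x == a) ∧ (y == b)) ∨ ((x == b) ∧ (y == a)))

-- Subdivide every edge of a list of edges of G (each once); the new
-- vertices are prepended, old vertex x becomes length F ↑ʳ x.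
subdivide : {n : ℕ} → Graph n → (F : List (Fin n × Fin n)) → Graph (length F + n)
subdivide G [] = G
subdivide G ((a , b) ∷ F) =
  subdivide1 (subdivide G F) (length F ↑ʳ a) (length F ↑ʳ b)

SameEdge : {n : ℕ} → (Fin n × Fin n) → (Fin n × Fin n) → Set
SameEdge (a , b) (c , d) = (a ≡ c × b ≡ d) ⊎ (a ≡ d × b ≡ c)

IsEdgeList : {n : ℕ} → Graph n → List (Fin n × Fin n) → Set
IsEdgeList G F = All (λ e → Adj G (Data.Product.proj₁ e) (Data.Product.proj₂ e)) F
               × AllPairs (λ e f → ¬ SameEdge e f) F

γtIncreases : {n m : ℕ} → Graph n → Graph m → Set
γtIncreases G G' = Σ ℕ (λ k → γtIs G k × (∀ S' → IsTDS G' S' → k < ∣ S' ∣))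

sdγtIs : {n : ℕ} → Graph n → ℕ → Set
sdγtIs G k =
  Σ (List _) (λ F → IsEdgeList G F × length F ≡ k × γtIncreases G (subdivide G F))
  × (∀ F → IsEdgeList G F → length F < k → ¬ γtIncreases G (subdivide G F))

-- Subdivide uv by a new vertex w, and let S be a total dominating set of the
-- subdivided tree with |S| ≤ γt(T).  If w ∉ S, then S is a γt(T)-set in which
-- u and v are dominated by vertices other than v and u; this contradicts (1)
-- when exactly one of u, v lies in S and (2) when both do, while w is
-- undominated when neither does.  If w ∈ S, some neighbour of w, say u, lies in
-- S − w; if v did too, S − w would dominate T with fewer than γt(T) vertices.
-- So D = (S − w) ∪ {v} is a γt(T)-set containing u and v in which D − v
-- dominates every vertex but u and v.  Then v has no private neighbour and no
-- x ∈ D − u has v as its only D-neighbour, which contradicts (2).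
module Submission where

open import Defs
open import Data.Nat using (ℕ; zero; suc; _≥_; _≤_; _<_; s≤s; _<?_)
open import Data.Nat.Properties using (≤-trans; ≤-refl; <-≤-trans; ≤-pred; n≤1+n; ≮⇒≥; ≰⇒>; <-irrefl)
open import Data.Fin using (Fin; zero; suc; _≟_; punchIn)
open import Data.Fin.Properties using (all?; any?; punchInᵢ≢i)
open import Data.Fin.Subset using (Subset; _∈_; _∉_; _⊆_; _∩_; _∪_; ⁅_⁆; ∣_∣; ⊤; inside; outside)
open import Data.Fin.Subset.Properties
  using ( _∈?_; ∈⊤; ⊆-refl; anySubset?; ∪-identityʳ; p⊆p∪q; x∈p∪q⁺; x∈p∩q⁺; x∈p∩q⁻
        ; x∈⁅x⁆; x∈⁅y⁆⇒x≡y; ∣p∣≤n)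
open import Data.Bool using (true; false; _∧_; _∨_; not)
open import Data.Bool.Properties using (∨-comm; ∧-conicalˡ; ∧-zeroʳ)
import Data.Bool.Properties as Bool
open import Data.Vec using (_∷_; here; there)
open import Data.Vec.Properties using ([]=⇒lookup; lookup⇒[]=; lookup∘tabulate)
open import Data.Product using (Σ; _×_; _,_; proj₁; proj₂)
open import Data.Sum using (_⊎_; inj₁; inj₂; [_,_])
open import Data.List using ([]; _∷_)
open import Data.List.Relation.Unary.All using ([]; _∷_)
open import Data.List.Relation.Unary.AllPairs using ([]; _∷_)
open import Relation.Binary.Construct.Closure.ReflexiveTransitive using (Star; ε; _◅_)
open import Relation.Nullary using (¬_; Dec; yes; no; contradiction)
open import Relation.Nullary.Decidable using (_×-dec_)
open import Relation.Binary.PropositionalEquality using (_≡_; _≢_; refl; sym; trans; cong; subst)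

module _ {n : ℕ} (G : Graph n) where

  ∈N⇒Adj : ∀ {x y} → y ∈ N G x → Adj G x y
  ∈N⇒Adj {x} {y} y∈Nx = trans (sym (lookup∘tabulate (G x) y)) ([]=⇒lookup y∈Nx)

  Adj⇒∈N : ∀ {x y} → Adj G x y → y ∈ N G x
  Adj⇒∈N {x} {y} xy = lookup⇒[]= y _ (trans (lookup∘tabulate (G x) y) xy)

  N∩≡⁅⁆⇒≡ : ∀ {D x y z} → N G x ∩ D ≡ ⁅ z ⁆ → y ∈ D → Adj G x y → y ≡ z
  N∩≡⁅⁆⇒≡ {z = z} Nx∩D≡z y∈D xy = x∈⁅y⁆⇒x≡y z (subst (_ ∈_) Nx∩D≡z (x∈p∩q⁺ (Adj⇒∈N xy , y∈D)))

  dominated⇒∉PN : ∀ {u D x y} → y ∈ D → y ≢ u → Adj G y x → ¬ InPN G u D x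
  dominated⇒∉PN y∈D y≢u yx (_ , unshared) = unshared (_ , y∈D , y≢u , inj₂ (Adj⇒∈N yx))

  tds? : ∀ S → Dec (IsTDS G S)
  tds? S = all? λ x → any? λ y → (y ∈? S) ×-dec (G x y Bool.≟ true)

  IsγtSet-≤ : ∀ {D S} → IsγtSet G D → IsTDS G S → ∣ S ∣ ≤ ∣ D ∣ → IsγtSet G S
  IsγtSet-≤ (_ , minimal) S-tds S≤D = S-tds , λ S′ S′-tds → ≤-trans S≤D (minimal S′ S′-tds)

  γtSet-exists : ∀ {S} → IsTDS G S → Σ (Subset n) (IsγtSet G)
  γtSet-exists {S} S-tds = γtSet-below (suc n) S S-tds (s≤s (∣p∣≤n S))
    where
    γtSet-below : ∀ m S → IsTDS G S → ∣ S ∣ < m → Σ (Subset n) (IsγtSet G)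
    γtSet-below (suc m) S S-tds S<1+m
      with anySubset? (λ S′ → tds? S′ ×-dec (∣ S′ ∣ <? ∣ S ∣))
    ... | no ∄smaller = S , S-tds , λ S′ S′-tds → ≮⇒≥ λ S′<S → ∄smaller (S′ , S′-tds , S′<S)
    ... | yes (S′ , S′-tds , S′<S) = γtSet-below m S′ S′-tds (<-≤-trans S′<S (≤-pred S<1+m))

  ⊤-isTDS : 2 ≤ n → Connected G → IsTDS G ⊤
  ⊤-isTDS (s≤s (s≤s _)) connected x = first-step (punchInᵢ≢i x zero) (connected x (punchIn x zero))
    where
    first-step : ∀ {y} → y ≢ x → Star (Adj G) x y → Σ (Fin n) (λ z → z ∈ ⊤ × Adj G x z)
    first-step y≢x ε = contradiction refl y≢x
    first-step _ (xz ◅ _) = _ , ∈⊤ , xz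

  ¬γtIncreases-refl : ¬ γtIncreases G G
  ¬γtIncreases-refl (_ , (D , (D-tds , _) , ∣D∣≡k) , increased) =
    <-irrefl (sym ∣D∣≡k) (increased D D-tds)

==⇒≡ : ∀ {n} {x y : Fin n} → (x == y) ≡ true → x ≡ y
==⇒≡ {x = x} {y} x==y with x ≟ y
... | yes x≡y = x≡y
... | no _ = contradiction x==y λ ()

==-refl : ∀ {n} (x : Fin n) → (x == x) ≡ true
==-refl x with x ≟ x
... | yes _ = refl
... | no x≢x = contradiction refl x≢x

∨-==⇒≡ : ∀ {n} (x a b : Fin n) → ((x == a) ∨ (x == b)) ≡ true → x ≡ a ⊎ x ≡ b
∨-==⇒≡ x a b x∈ab with x == a in x==a
... | true = inj₁ (==⇒≡ x==a)
... | false = inj₂ (==⇒≡ x∈ab)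

module _ {n : ℕ} (G : Graph n) (a b : Fin n) where

  subdivide1-comm : ∀ x y → subdivide1 G a b x y ≡ subdivide1 G b a x y
  subdivide1-comm zero zero = refl
  subdivide1-comm zero (suc y) = ∨-comm (y == a) (y == b)
  subdivide1-comm (suc x) zero = ∨-comm (x == a) (x == b)
  subdivide1-comm (suc x) (suc y) =
    cong (λ cut → G x y ∧ not cut) (∨-comm ((x == a) ∧ (y == b)) ((x == b) ∧ (y == a)))

  subdivide1-TDS-comm : ∀ {S} → IsTDS (subdivide1 G a b) S → IsTDS (subdivide1 G b a) S
  subdivide1-TDS-comm S-tds x with S-tds x
  ... | y , y∈S , xy = y , y∈S , trans (sym (subdivide1-comm x y)) xy

  private
    G′ : Graph (suc n)
    G′ = subdivide1 G a b

  subdivide1-old : ∀ {x y} → Adj G′ (suc x) (suc y) → Adj G x y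
  subdivide1-old {x} = ∧-conicalˡ (G x _) _

  subdivide1-cut : ¬ Adj G′ (suc a) (suc b)
  subdivide1-cut ab = contradiction (trans (sym erased) ab) λ ()
    where
    erased : G′ (suc a) (suc b) ≡ false
    erased rewrite ==-refl a | ==-refl b = ∧-zeroʳ (G a b)

  new-vertex-dominated : ∀ {s D} → IsTDS G′ (s ∷ D) → a ∈ D ⊎ b ∈ D
  new-vertex-dominated S-tds with S-tds zero
  ... | suc y , there y∈D , wy with ∨-==⇒≡ y a b wy
  ...   | inj₁ refl = inj₁ y∈D
  ...   | inj₂ refl = inj₂ y∈D

  other-dominated : ∀ {s D x} → IsTDS G′ (s ∷ D) → x ≢ a → x ≢ b →
                    Σ (Fin n) (λ y → y ∈ D × Adj G x y)
  other-dominated {x = x} S-tds x≢a x≢b with S-tds (suc x)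
  ... | suc y , there y∈D , xy = y , y∈D , subdivide1-old xy
  ... | zero , _ , xw = contradiction (∨-==⇒≡ x a b xw) [ x≢a , x≢b ]

  endpoint-dominated : ∀ {D} → IsTDS G′ (false ∷ D) →
                       Σ (Fin n) (λ y → y ∈ D × Adj G a y × y ≢ b)
  endpoint-dominated S-tds with S-tds (suc a)
  ... | suc y , there y∈D , ay = y , y∈D , subdivide1-old ay , λ { refl → subdivide1-cut ay }

  restrict-TDS : ∀ {s D E} → Adj G a b → Adj G b a → IsTDS G′ (s ∷ D) →
                 (s ≡ true → a ∈ E × b ∈ E) → D ⊆ E → IsTDS G E
  restrict-TDS ab ba S-tds ends D⊆E x with S-tds (suc x)
  ... | suc y , there y∈D , xy = y , D⊆E y∈D , subdivide1-old xy
  ... | zero , here , xw with ∨-==⇒≡ x a b xw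
  ...   | inj₁ refl = b , proj₂ (ends refl) , ab
  ...   | inj₂ refl = a , proj₁ (ends refl) , ba

∣p∪⁅x⁆∣≤1+∣p∣ : ∀ {n} (p : Subset n) x → ∣ p ∪ ⁅ x ⁆ ∣ ≤ suc ∣ p ∣
∣p∪⁅x⁆∣≤1+∣p∣ (inside ∷ p) zero rewrite ∪-identityʳ p = n≤1+n _
∣p∪⁅x⁆∣≤1+∣p∣ (outside ∷ p) zero rewrite ∪-identityʳ p = ≤-refl
∣p∪⁅x⁆∣≤1+∣p∣ (inside ∷ p) (suc x) = s≤s (∣p∪⁅x⁆∣≤1+∣p∣ p x)
∣p∪⁅x⁆∣≤1+∣p∣ (outside ∷ p) (suc x) = ∣p∪⁅x⁆∣≤1+∣p∣ p x

-- v cannot be dropped from D: it has a private neighbour, or a vertex x ≠ u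
-- of D has v as its only neighbour in D.
Essential : ∀ {n} → Graph n → Subset n → Fin n → Fin n → Set
Essential {n} G D v u =
  PNNonempty G v D ⊎ Σ (Fin n) (λ x → x ∈ N G v ∩ D × x ≢ u × N G x ∩ D ≡ ⁅ v ⁆)

module _ {n : ℕ} {G : Graph n} (simple : IsSimple G) where

  Adj-sym : ∀ {x y} → Adj G x y → Adj G y x
  Adj-sym {x} {y} xy = trans (proj₁ simple y x) xy

  Adj⇒≢ : ∀ {x y} → Adj G x y → x ≢ y
  Adj⇒≢ {x} xx refl = contradiction (trans (sym (proj₂ simple x)) xx) λ ()

  dominated-except⇒¬Essential : ∀ {D a b} → Adj G a b → a ∈ D → b ∉ D →
               (∀ x → x ≢ a → x ≢ b → Σ (Fin n) (λ y → y ∈ D × Adj G x y)) →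
               ¬ Essential G (D ∪ ⁅ b ⁆) b a
  dominated-except⇒¬Essential {D} {a} {b} ab a∈D b∉D dominated = [ no-private , no-pending ]
    where
    a≢b : a ≢ b
    a≢b = Adj⇒≢ ab

    D-dominated : ∀ {x} → x ≢ a → x ≢ b → Σ (Fin n) (λ y → y ∈ D × Adj G x y × y ≢ b)
    D-dominated {x} x≢a x≢b with dominated x x≢a x≢b
    ... | y , y∈D , xy = y , y∈D , xy , λ { refl → b∉D y∈D }

    no-private : ¬ PNNonempty G b (D ∪ ⁅ b ⁆)
    no-private (p , p∈N[b] , unshared) =
      let y , y∈D , py , y≢b = D-dominated p≢a p≢b
      in dominated⇒∉PN G (p⊆p∪q ⁅ b ⁆ y∈D) y≢b (Adj-sym py) (p∈N[b] , unshared)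
      where
      p≢a : p ≢ a
      p≢a refl = unshared (a , p⊆p∪q ⁅ b ⁆ a∈D , a≢b , inj₁ refl)
      p≢b : p ≢ b
      p≢b refl = unshared (a , p⊆p∪q ⁅ b ⁆ a∈D , a≢b , inj₂ (Adj⇒∈N G ab))

    no-pending : ¬ Σ (Fin n) (λ x → x ∈ N G b ∩ (D ∪ ⁅ b ⁆) × x ≢ a × N G x ∩ (D ∪ ⁅ b ⁆) ≡ ⁅ b ⁆)
    no-pending (x , x∈Nb∩D′ , x≢a , Nx∩D′≡b) =
      let y , y∈D , xy , y≢b = D-dominated x≢a x≢b
      in y≢b (N∩≡⁅⁆⇒≡ G Nx∩D′≡b (p⊆p∪q ⁅ b ⁆ y∈D) xy)
      where
      x≢b : x ≢ b
      x≢b x≡b = Adj⇒≢ (∈N⇒Adj G (proj₁ (x∈p∩q⁻ _ _ x∈Nb∩D′))) (sym x≡b)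

  subdivide1-TDS⇒¬InPN : ∀ {D a b} → IsTDS (subdivide1 G a b) (false ∷ D) → ¬ InPN G a D b
  subdivide1-TDS⇒¬InPN {a = a} {b} S-tds
    with endpoint-dominated G b a (subdivide1-TDS-comm G a b S-tds)
  ... | y , y∈D , by , y≢a = dominated⇒∉PN G y∈D y≢a (Adj-sym by)

  subdivide1-TDS⇒N∩≢⁅⁆ : ∀ {D a b} → IsTDS (subdivide1 G a b) (false ∷ D) → N G a ∩ D ≢ ⁅ b ⁆
  subdivide1-TDS⇒N∩≢⁅⁆ {a = a} {b} S-tds Na∩D≡b with endpoint-dominated G a b S-tds
  ... | y , y∈D , ay , y≢b = y≢b (N∩≡⁅⁆⇒≡ G Na∩D≡b y∈D ay)

  subdivide1-TDS⇒γt≤ : ∀ {D★ D a b} → IsγtSet G D★ → Adj G a b →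
                       (∀ D → IsγtSet G D → a ∈ D → b ∈ D → Essential G D b a) →
                       IsTDS (subdivide1 G a b) (true ∷ D) → a ∈ D → b ∉ D → ∣ D★ ∣ ≤ ∣ D ∣
  subdivide1-TDS⇒γt≤ {D★} {D} {a} {b} D★-γt ab essential S-tds a∈D b∉D = ≮⇒≥ λ 1+D≤D★ →
    dominated-except⇒¬Essential ab a∈D b∉D (λ _ → other-dominated G a b S-tds)
      (essential D′ (IsγtSet-≤ G D★-γt D′-tds (≤-trans (∣p∪⁅x⁆∣≤1+∣p∣ D b) 1+D≤D★)) a∈D′ b∈D′)
    where
    D′ : Subset n
    D′ = D ∪ ⁅ b ⁆
    a∈D′ : a ∈ D′
    a∈D′ = p⊆p∪q ⁅ b ⁆ a∈D
    b∈D′ : b ∈ D′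
    b∈D′ = x∈p∪q⁺ (inj₂ (x∈⁅x⁆ b))
    D′-tds : IsTDS G D′
    D′-tds = restrict-TDS G a b ab (Adj-sym ab) S-tds (λ _ → a∈D′ , b∈D′) (p⊆p∪q ⁅ b ⁆)

module _ {n : ℕ} {T : Graph n} (simple : IsSimple T) {u v : Fin n} (uv : Adj T u v)
  (private-u : ∀ D → IsγtSet T D → u ∈ D → v ∉ D → InPN T u D v)
  (private-v : ∀ D → IsγtSet T D → v ∈ D → u ∉ D → InPN T v D u)
  (sole-neighbour : ∀ D → IsγtSet T D → u ∈ D → v ∈ D → N T u ∩ D ≡ ⁅ v ⁆ ⊎ N T v ∩ D ≡ ⁅ u ⁆)
  (essential : ∀ D → IsγtSet T D → u ∈ D → v ∈ D → Essential T D v u × Essential T D u v)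
  {D★ : Subset n} (D★-γt : IsγtSet T D★)
  where

  subdivide1-increases-γt : ∀ S → IsTDS (subdivide1 T u v) S → ∣ D★ ∣ < ∣ S ∣
  subdivide1-increases-γt (outside ∷ D) S-tds =
    ≰⇒> λ D≤D★ → D-not-γt (IsγtSet-≤ T D★-γt D-tds D≤D★)
    where
    D-tds : IsTDS T D
    D-tds = restrict-TDS T u v uv (Adj-sym simple uv) S-tds (λ ()) ⊆-refl
    S-tds′ : IsTDS (subdivide1 T v u) (outside ∷ D)
    S-tds′ = subdivide1-TDS-comm T u v S-tds
    D-not-γt : ¬ IsγtSet T D
    D-not-γt D-γt with u ∈? D | v ∈? D
    ... | yes u∈D | yes v∈D =
      [ subdivide1-TDS⇒N∩≢⁅⁆ simple S-tds , subdivide1-TDS⇒N∩≢⁅⁆ simple S-tds′ ]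
        (sole-neighbour D D-γt u∈D v∈D)
    ... | yes u∈D | no v∉D = subdivide1-TDS⇒¬InPN simple S-tds (private-u D D-γt u∈D v∉D)
    ... | no u∉D | yes v∈D = subdivide1-TDS⇒¬InPN simple S-tds′ (private-v D D-γt v∈D u∉D)
    ... | no u∉D | no v∉D = [ u∉D , v∉D ] (new-vertex-dominated T u v S-tds)
  subdivide1-increases-γt (inside ∷ D) S-tds with u ∈? D | v ∈? D
  ... | yes u∈D | yes v∈D =
    s≤s (proj₂ D★-γt D (restrict-TDS T u v uv (Adj-sym simple uv) S-tds (λ _ → u∈D , v∈D) ⊆-refl))
  ... | yes u∈D | no v∉D = s≤s (subdivide1-TDS⇒γt≤ simple D★-γt uv
                                  (λ D D-γt u∈D v∈D → proj₁ (essential D D-γt u∈D v∈D))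
                                  S-tds u∈D v∉D)
  ... | no u∉D | yes v∈D = s≤s (subdivide1-TDS⇒γt≤ simple D★-γt (Adj-sym simple uv)
                                  (λ D D-γt v∈D u∈D → proj₂ (essential D D-γt u∈D v∈D))
                                  (subdivide1-TDS-comm T u v S-tds) v∈D u∉D)
  ... | no u∉D | no v∉D = contradiction (new-vertex-dominated T u v S-tds) [ u∉D , v∉D ]

γtIncreases⇒sdγtIs1 : ∀ {n} {G : Graph n} {a b} → Adj G a b →
                      γtIncreases G (subdivide1 G a b) → sdγtIs G 1
γtIncreases⇒sdγtIs1 {G = G} ab increases =
  ((_ , _) ∷ [] , (ab ∷ [] , [] ∷ []) , refl , increases) ,
  λ { [] _ _ → ¬γtIncreases-refl G ; (_ ∷ _) _ (s≤s ()) }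

lemma18 : (n : ℕ) → n ≥ 3 → (T : Graph n) → IsTree T →
    (u v : Fin n) → InnerEdge T u v →
    (∀ (D : Subset n) → IsγtSet T D →
      ((u ∈ D × v ∉ D → InPN T u D v)
       × (v ∈ D × u ∉ D → InPN T v D u)
       × (u ∈ D × v ∈ D →
           ((N T u ∩ D ≡ ⁅ v ⁆) ⊎ (N T v ∩ D ≡ ⁅ u ⁆))
           × (N T u ∩ D ≡ ⁅ v ⁆ →
               PNNonempty T u D
               × (PNNonempty T v D
                  ⊎ Σ (Fin n) (λ x → x ∈ N T v ∩ D × x ≢ u × N T x ∩ D ≡ ⁅ v ⁆)))
           × (N T v ∩ D ≡ ⁅ u ⁆ →
               PNNonempty T v D
               × (PNNonempty T u D
                  ⊎ Σ (Fin n) (λ x → x ∈ N T u ∩ D × x ≢ v × N T x ∩ D ≡ ⁅ u ⁆)))))) →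
    sdγtIs T 1
lemma18 n n≥3 T (simple , connected , _) u v (uv , _) conditions =
  γtIncreases⇒sdγtIs1 uv
    (∣ D★ ∣ , (D★ , D★-γt , refl) ,
     subdivide1-increases-γt simple uv private-u private-v sole-neighbour essential D★-γt)
  where
  γt-witness : Σ (Subset n) (IsγtSet T)
  γt-witness = γtSet-exists T (⊤-isTDS T (≤-trans (n≤1+n 2) n≥3) connected)
  D★ : Subset n
  D★ = proj₁ γt-witness
  D★-γt : IsγtSet T D★
  D★-γt = proj₂ γt-witness

  private-u : ∀ D → IsγtSet T D → u ∈ D → v ∉ D → InPN T u D v
  private-u D D-γt u∈D v∉D = proj₁ (conditions D D-γt) (u∈D , v∉D)
  private-v : ∀ D → IsγtSet T D → v ∈ D → u ∉ D → InPN T v D u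
  private-v D D-γt v∈D u∉D = proj₁ (proj₂ (conditions D D-γt)) (v∈D , u∉D)
  sole-neighbour : ∀ D → IsγtSet T D → u ∈ D → v ∈ D → N T u ∩ D ≡ ⁅ v ⁆ ⊎ N T v ∩ D ≡ ⁅ u ⁆
  sole-neighbour D D-γt u∈D v∈D = proj₁ (proj₂ (proj₂ (conditions D D-γt)) (u∈D , v∈D))
  essential : ∀ D → IsγtSet T D → u ∈ D → v ∈ D → Essential T D v u × Essential T D u v
  essential D D-γt u∈D v∈D with proj₂ (proj₂ (conditions D D-γt)) (u∈D , v∈D)
  ... | inj₁ Nu∩D≡v , if-u , _ = proj₂ (if-u Nu∩D≡v) , inj₁ (proj₁ (if-u Nu∩D≡v))
  ... | inj₂ Nv∩D≡u , _ , if-v = inj₁ (proj₁ (if-v Nv∩D≡u)) , proj₂ (if-v Nv∩D≡u)
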